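{- Let $\overline{n}=(\overline{n}_1,\overline{n}_2)\in\mathbb{N}_{>0}^2$, $n=\overline{n}_1+\overline{n}_2$, let $r\ge 2$, and let $\mathcal{M}\in\mathbb{N}^{r\times 2}$ have rows $m^1,\dots,m^r$ such that $0\le m^i_j\le\overline{n}_j$ for all $1\le i\le r$, $j\in\{1,2\}$, and $m^i_1>m^{i+1}_1$ and $m^i_2<m^{i+1}_2$ for all $1\le i\le r-1$. Then there are non-negative integers $x_1,\dots,x_r,y_1,\dots,y_r,z_1,z_2$ with $$\sum_{i=1}^r x_i+\sum_{i=1}^r y_i+z_1+z_2=n+2-2r$$ such that $$\overline{n}=\Big(z_1+r-1+\sum_{j=1}^r x_j,\; z_2+r-1+\sum_{j=1}^r y_j\Big)$$ and, for each $1\le i\le r$, the $i$-th row of $\mathcal{M}$ is $$m^i=\Big(r-i+\sum_{j=1}^{r-i+1}x_j,\; i-1+\sum_{j=1}^{i}y_j\Big).$$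
   Context: Here $\mathbb{N}=\{0,1,2,\dots\}$ and $\mathbb{N}_{>0}$ denotes the positive integers. -}

module Defs where

open import Data.Nat using (ℕ; zero; suc; _+_; _<_)
open import Data.Fin using (Fin; toℕ)

-- prefix sum: psum {r} x k = Σ_{j : Fin r, toℕ j < k} x j
-- (0-based indices; paper's Σ_{j=1}^{k} x_j with x_j = x (j-1))
psum : {r : ℕ} → (Fin r → ℕ) → ℕ → ℕ
psum {zero} x k = 0
psum {suc r} x zero = 0
psum {suc r} x (suc k) = x Fin.zero + psum {r} (λ j → x (Fin.suc j)) k
  where import Data.Fin as Fin

total : {r : ℕ} → (Fin r → ℕ) → ℕ
total {r} x = psum x r

{-# OPTIONS --safe #-}
module Submission where

-- A sequence e₀ < e₁ < ⋯ < e_{r-1} of naturals is determined by its gaps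
-- g₀ = e₀ and g_{k+1} = e_{k+1} − e_k − 1, and then e_k = k + g₀ + ⋯ + g_k.
-- The second column of 𝓜 is increasing and the first one is increasing when
-- read bottom-up, so their gaps give y and x; z₁ and z₂ are the slacks
-- n̄ⱼ − (largest entry of column j), and the size constraint is the sum of
-- the two resulting equations for n̄₁ and n̄₂.

open import Defs
open import Data.Nat using (ℕ; zero; suc; _+_; _*_; _∸_; _≤_; _<_; _>_; z≤n; s≤s)
open import Data.Nat.Properties
  using (+-identityʳ; +-assoc; +-∸-assoc; m+[n∸m]≡n; m∸n+n≡m; n<1+n; <-trans)
open import Data.Nat.Solver using (module +-*-Solver)
open import Data.Fin using (Fin; zero; suc; toℕ; fromℕ; opposite)
open import Data.Fin.Properties using (toℕ<n; toℕ-fromℕ; opposite-prop; opposite-involutive)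
open import Data.Product using (Σ; _×_; _,_; proj₁; proj₂)
open import Function using (_∘_; flip)
open import Relation.Binary.PropositionalEquality
open ≡-Reasoning

m∸n≡suc[m∸suc[n]] : ∀ {m n} → n < m → m ∸ n ≡ suc (m ∸ suc n)
m∸n≡suc[m∸suc[n]] = +-∸-assoc 1

sumTo : (ℕ → ℕ) → ℕ → ℕ
sumTo g zero = 0
sumTo g (suc k) = g 0 + sumTo (g ∘ suc) k

sumTo-suc : ∀ g k → sumTo g (suc k) ≡ sumTo g k + g k
sumTo-suc g zero = +-identityʳ (g 0)
sumTo-suc g (suc k) = begin
  g 0 + sumTo (g ∘ suc) (suc k)         ≡⟨ cong (g 0 +_) (sumTo-suc (g ∘ suc) k) ⟩
  g 0 + (sumTo (g ∘ suc) k + g (suc k)) ≡⟨ sym (+-assoc (g 0) _ _) ⟩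
  sumTo g (suc k) + g (suc k)           ∎

psum-toℕ : ∀ {r} (g : ℕ → ℕ) {k} → k ≤ r → psum {r} (g ∘ toℕ) k ≡ sumTo g k
psum-toℕ {zero}  g z≤n         = refl
psum-toℕ {suc r} g {zero}  _   = refl
psum-toℕ {suc r} g {suc k} (s≤s k≤r) = cong (g 0 +_) (psum-toℕ (g ∘ suc) k≤r)

gaps : (ℕ → ℕ) → ℕ → ℕ
gaps e zero    = e 0
gaps e (suc k) = e (suc k) ∸ suc (e k)

IncreasingBelow : ℕ → (ℕ → ℕ) → Set
IncreasingBelow r e = ∀ k → suc k < r → e k < e (suc k)

gaps-telescope : ∀ {r e} → IncreasingBelow r e →
                 ∀ k → k < r → e k ≡ k + sumTo (gaps e) (suc k)
gaps-telescope {e = e} inc zero    _   = sym (+-identityʳ (e 0))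
gaps-telescope {e = e} inc (suc k) k<r = begin
  e (suc k)                                        ≡⟨ sym (m+[n∸m]≡n (inc k k<r)) ⟩
  suc (e k) + gaps e (suc k)                       ≡⟨ cong (λ t → suc t + gaps e (suc k)) e-k ⟩
  suc (k + sumTo (gaps e) (suc k)) + gaps e (suc k) ≡⟨ cong suc (+-assoc k _ _) ⟩
  suc k + (sumTo (gaps e) (suc k) + gaps e (suc k)) ≡⟨ cong (suc k +_) (sym (sumTo-suc (gaps e) (suc k))) ⟩
  suc k + sumTo (gaps e) (suc (suc k))             ∎
  where e-k = gaps-telescope inc k (<-trans (n<1+n k) k<r)

Consecutive : ∀ {r} → (ℕ → ℕ → Set) → (Fin r → ℕ) → Set
Consecutive R f = ∀ i j → suc (toℕ i) ≡ toℕ j → R (f i) (f j)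

consecutive-opposite : ∀ {r R} {f : Fin r → ℕ} →
                       Consecutive (flip R) f → Consecutive R (f ∘ opposite)
consecutive-opposite {r} {f = f} c i j i+1≡j = c (opposite j) (opposite i) (begin
  suc (toℕ (opposite j)) ≡⟨ cong suc (opposite-prop j) ⟩
  suc (r ∸ suc (toℕ j))  ≡⟨ sym (m∸n≡suc[m∸suc[n]] (toℕ<n j)) ⟩
  r ∸ toℕ j              ≡⟨ cong (r ∸_) (sym i+1≡j) ⟩
  r ∸ suc (toℕ i)        ≡⟨ sym (opposite-prop i) ⟩
  toℕ (opposite i)       ∎)

-- f extended by 0 past r, so that gaps can be taken along ℕ.
atℕ : ∀ {r} → (Fin r → ℕ) → ℕ → ℕ
atℕ {zero}  f k       = 0
atℕ {suc r} f zero    = f zero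
atℕ {suc r} f (suc k) = atℕ (f ∘ suc) k

atℕ-toℕ : ∀ {r} (f : Fin r → ℕ) i → atℕ f (toℕ i) ≡ f i
atℕ-toℕ f zero    = refl
atℕ-toℕ f (suc i) = atℕ-toℕ (f ∘ suc) i

atℕ-consecutive : ∀ {r R} {f : Fin r → ℕ} → Consecutive R f →
                  ∀ k → suc k < r → R (atℕ f k) (atℕ f (suc k))
atℕ-consecutive {suc zero}    c k       (s≤s ())
atℕ-consecutive {suc (suc r)} c zero    _ = c zero (suc zero) refl
atℕ-consecutive {suc (suc r)} {R} {f} c (suc k) (s≤s k+1<r) =
  atℕ-consecutive {R = R} {f = f ∘ suc} (λ i j e → c (suc i) (suc j) (cong suc e)) k k+1<r

gapsFin : ∀ {r} → (Fin r → ℕ) → Fin r → ℕ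
gapsFin f = gaps (atℕ f) ∘ toℕ

increasing⇒≡index+psum-gaps : ∀ {r} {f : Fin r → ℕ} → Consecutive _<_ f →
                               ∀ i → f i ≡ toℕ i + psum (gapsFin f) (suc (toℕ i))
increasing⇒≡index+psum-gaps {f = f} inc i = begin
  f i                                       ≡⟨ sym (atℕ-toℕ f i) ⟩
  atℕ f (toℕ i)                             ≡⟨ gaps-telescope {e = atℕ f} (atℕ-consecutive {R = _<_} inc) (toℕ i) (toℕ<n i) ⟩
  toℕ i + sumTo (gaps (atℕ f)) (suc (toℕ i)) ≡⟨ cong (toℕ i +_) (sym (psum-toℕ (gaps (atℕ f)) (toℕ<n i))) ⟩
  toℕ i + psum (gapsFin f) (suc (toℕ i))    ∎

increasing⇒≡slack+index+total-gaps : ∀ {r n} {f : Fin (suc r) → ℕ} → Consecutive _<_ f →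
  f (fromℕ r) ≤ n → n ≡ (n ∸ f (fromℕ r)) + r + total (gapsFin f)
increasing⇒≡slack+index+total-gaps {r} {n} {f} inc fr≤n = begin
  n                                     ≡⟨ sym (m∸n+n≡m fr≤n) ⟩
  slack + f (fromℕ r)                   ≡⟨ cong (slack +_) (increasing⇒≡index+psum-gaps inc (fromℕ r)) ⟩
  slack + (toℕ (fromℕ r) + psum (gapsFin f) (suc (toℕ (fromℕ r))))
    ≡⟨ cong (λ t → slack + (t + psum (gapsFin f) (suc t))) (toℕ-fromℕ r) ⟩
  slack + (r + total (gapsFin f))       ≡⟨ sym (+-assoc slack r _) ⟩
  slack + r + total (gapsFin f)         ∎
  where slack = n ∸ f (fromℕ r)

open +-*-Solver

mainTheorem4 : (n₁ n₂ : ℕ) → 0 < n₁ → 0 < n₂ →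
    (r : ℕ) → 2 ≤ r →
    (m₁ m₂ : Fin r → ℕ) →
    (∀ i → m₁ i ≤ n₁) → (∀ i → m₂ i ≤ n₂) →
    (∀ (i j : Fin r) → suc (toℕ i) ≡ toℕ j → m₁ i > m₁ j × m₂ i < m₂ j) →
    Σ (Fin r → ℕ) λ x → Σ (Fin r → ℕ) λ y → Σ ℕ λ z₁ → Σ ℕ λ z₂ →
      (total x + total y + z₁ + z₂ + 2 * r ≡ n₁ + n₂ + 2)
      × (n₁ ≡ z₁ + (r ∸ 1) + total x)
      × (n₂ ≡ z₂ + (r ∸ 1) + total y)
      × (∀ (i : Fin r) →
           (m₁ i ≡ (r ∸ suc (toℕ i)) + psum x (r ∸ toℕ i))
           × (m₂ i ≡ toℕ i + psum y (suc (toℕ i))))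
mainTheorem4 n₁ n₂ _ _ (suc r) _ m₁ m₂ m₁≤n₁ m₂≤n₂ steps =
  gapsFin m₁ᵒᵖ , gapsFin m₂ , z₁ , z₂ , size , n₁≡ , n₂≡ , λ i → row₁ i , row₂ i
  where
  m₁ᵒᵖ = m₁ ∘ opposite
  inc₁ : Consecutive _<_ m₁ᵒᵖ
  inc₁ = consecutive-opposite {R = _<_} {f = m₁} (λ i j e → proj₁ (steps i j e))
  inc₂ : Consecutive _<_ m₂
  inc₂ i j e = proj₂ (steps i j e)
  z₁ = n₁ ∸ m₁ᵒᵖ (fromℕ r)
  z₂ = n₂ ∸ m₂ (fromℕ r)
  n₁≡ = increasing⇒≡slack+index+total-gaps inc₁ (m₁≤n₁ _)
  n₂≡ = increasing⇒≡slack+index+total-gaps inc₂ (m₂≤n₂ _)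
  size = trans
    (solve 5 (λ a b c d e → a :+ b :+ c :+ d :+ con 2 :* (con 1 :+ e)
                          := c :+ e :+ a :+ (d :+ e :+ b) :+ con 2) refl
           (total (gapsFin m₁ᵒᵖ)) (total (gapsFin m₂)) z₁ z₂ r)
    (sym (cong₂ (λ a b → a + b + 2) n₁≡ n₂≡))
  row₂ = increasing⇒≡index+psum-gaps inc₂
  row₁ : ∀ i → m₁ i ≡ (suc r ∸ suc (toℕ i)) + psum (gapsFin m₁ᵒᵖ) (suc r ∸ toℕ i)
  row₁ i = begin
    m₁ i                          ≡⟨ cong m₁ (sym (opposite-involutive i)) ⟩
    m₁ᵒᵖ (opposite i)             ≡⟨ increasing⇒≡index+psum-gaps inc₁ (opposite i) ⟩
    toℕ (opposite i) + psum x (suc (toℕ (opposite i)))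
      ≡⟨ cong (λ t → t + psum x (suc t)) (opposite-prop i) ⟩
    k + psum x (suc k)            ≡⟨ cong (λ t → k + psum x t) (sym (m∸n≡suc[m∸suc[n]] (toℕ<n i))) ⟩
    k + psum x (suc r ∸ toℕ i)    ∎
    where
    x = gapsFin m₁ᵒᵖ
    k = suc r ∸ suc (toℕ i)
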